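{- Let $n\ge 1$ and let $k_1 \le k_2 \le \cdots \le k_n$ be weakly increasing integers. A triangular array $(a_{i,j})_{1 \le j \le i \le n}$ of integers, each decorated with an element of $\{\nwarrow,\nearrow,\nwarrow\!\nearrow,\emptyset\}$, with bottom row $(a_{n,1},\ldots,a_{n,n})=(k_1,\ldots,k_n)$, is an arrowed Gelfand-Tsetlin pattern if and only if the following hold: (i) $a_{i+1,j} \le a_{i,j} \le a_{i+1,j+1}$ for all $1 \le j \le i \le n-1$ (i.e. the underlying array is an ordinary Gelfand-Tsetlin pattern); (ii) whenever an entry $a_{i+1,j}$ with $j \le i$ is decorated with $\nearrow$ or $\nwarrow\!\nearrow$ and $a_{i+1,j}=a_{i,j}$, then $a_{i+1,j+1} = a_{i+1,j}$ and $a_{i+1,j+1}$ is decorated with $\nwarrow$ or $\nwarrow\!\nearrow$; (iii) whenever an entry $a_{i+1,j+1}$ with $j \le i$ is decorated with $\nwarrow$ or $\nwarrow\!\nearrow$ and $a_{i+1,j+1}=a_{i,j}$, then $a_{i+1,j}=a_{i+1,j+1}$ and $a_{i+1,j}$ is decorated with $\nearrow$ or $\nwarrow\!\nearrow$. Moreover, for such a pattern $A$, $\operatorname{sgn} A = (-1)^N$, where $N$ is the number of pairs $(i,j)$, $1\le j \le i \le n-1$, such that $a_{i,j}=a_{i+1,j}=a_{i+1,j+1}$, $a_{i+1,j}$ is decorated with $\nearrow$ or $\nwarrow\!\nearrow$, and $a_{i+1,j+1}$ is decorated with $\nwarrow$ or $\nwarrow\!\nearrow$.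
   Context: Signed intervals: for integers $a,b$, $\langle a,b\rangle = [a,b]$ if $a \le b$, $=\emptyset$ if $b=a-1$, and $=[b+1,a-1]$ if $b<a-1$; in the last case the interval is called negative. An arrowed Gelfand-Tsetlin pattern (AGTP) with $n$ rows is a triangular array $(a_{i,j})_{1\le j\le i\le n}$ of integers (row $i$ has entries $a_{i,1},\ldots,a_{i,i}$; the $\swarrow$- and $\searrow$-neighbours of $a_{i,j}$ are $a_{i+1,j}$ and $a_{i+1,j+1}$), each entry decorated with an element of $\{\nwarrow,\nearrow,\nwarrow\!\nearrow,\emptyset\}$, such that for each $1\le j\le i\le n-1$, writing $b=a_{i+1,j}$, $c=a_{i+1,j+1}$: $a_{i,j}\in\langle b', c'\rangle$, where $b'=b+1$ if $b$ is decorated with $\nearrow$ or $\nwarrow\!\nearrow$ and $b'=b$ otherwise, and $c'=c-1$ if $c$ is decorated with $\nwarrow$ or $\nwarrow\!\nearrow$ and $c'=c$ otherwise. The sign $\operatorname{sgn} A$ of an AGTP is $(-1)$ raised to the number of pairs $(i,j)$, $1 \le j \le i \le n-1$, for which this interval $\langle b',c'\rangle$ is negative. -}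

module Defs where

open import Data.Nat as ℕ using (ℕ; zero; suc)
open import Data.Integer using (ℤ; +_; _+_; _-_; -_; _*_; _≤_; _<_; _<?_; _≟_; 1ℤ)
open import Data.Bool using (Bool; true; false; if_then_else_; _∧_)
open import Data.Product using (_×_)
open import Data.Sum using (_⊎_)
open import Relation.Nullary.Decidable using (⌊_⌋)

data Arrow : Set where
  nw ne nwne none : Arrow

hasNE : Arrow → Bool
hasNE ne   = true
hasNE nwne = true
hasNE _    = false

hasNW : Arrow → Bool
hasNW nw   = true
hasNW nwne = true
hasNW _    = false

-- A decorated triangular array: entries a i j and decorations d i j for
-- 1 ≤ j ≤ i ≤ n (1-based, as in the paper); values outside the triangle
-- are irrelevant (never inspected).
Entries : Set
Entries = ℕ → ℕ → ℤ

Decos : Set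
Decos = ℕ → ℕ → Arrow

-- Signed interval ⟨b,c⟩ membership:
--  b ≤ c      : [b,c]
--  c = b - 1  : ∅
--  c < b - 1  : [c+1, b-1]  (negative)
_∈⟨_,_⟩ : ℤ → ℤ → ℤ → Set
x ∈⟨ b , c ⟩ = (b ≤ c × b ≤ x × x ≤ c) ⊎ (c + 1ℤ < b × c + 1ℤ ≤ x × x ≤ b - 1ℤ)

negativeB : ℤ → ℤ → Bool
negativeB b c = ⌊ c + 1ℤ <? b ⌋

left' : Entries → Decos → ℕ → ℕ → ℤ
left' a d i j = if hasNE (d (suc i) j) then a (suc i) j + 1ℤ else a (suc i) j

right' : Entries → Decos → ℕ → ℕ → ℤ
right' a d i j = if hasNW (d (suc i) (suc j)) then a (suc i) (suc j) - 1ℤ else a (suc i) (suc j)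

IsAGTP : ℕ → Entries → Decos → Set
IsAGTP n a d = ∀ i j → 1 ℕ.≤ j → j ℕ.≤ i → i ℕ.< n →
  a i j ∈⟨ left' a d i j , right' a d i j ⟩

countRow : (ℕ → Bool) → ℕ → ℕ
countRow P zero    = 0
countRow P (suc j) = countRow P j ℕ.+ (if P (suc j) then 1 else 0)

countTri' : (ℕ → ℕ → Bool) → ℕ → ℕ
countTri' P zero    = 0
countTri' P (suc i) = countTri' P i ℕ.+ countRow (P (suc i)) (suc i)

countTri : (ℕ → ℕ → Bool) → ℕ → ℕ
countTri P n = countTri' P (n ℕ.∸ 1)

neg1^ : ℕ → ℤ
neg1^ zero    = 1ℤ
neg1^ (suc m) = - neg1^ m

sgn : ℕ → Entries → Decos → ℤ
sgn n a d = neg1^ (countTri (λ i j → negativeB (left' a d i j) (right' a d i j)) n)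

specialB : Entries → Decos → ℕ → ℕ → Bool
specialB a d i j =
  ⌊ a i j ≟ a (suc i) j ⌋ ∧ ⌊ a (suc i) j ≟ a (suc i) (suc j) ⌋
  ∧ hasNE (d (suc i) j) ∧ hasNW (d (suc i) (suc j))

CondI : ℕ → Entries → Set
CondI n a = ∀ i j → 1 ℕ.≤ j → j ℕ.≤ i → i ℕ.< n →
  a (suc i) j ≤ a i j × a i j ≤ a (suc i) (suc j)

CondII : ℕ → Entries → Decos → Set
CondII n a d = ∀ i j → 1 ℕ.≤ j → j ℕ.≤ i → i ℕ.< n →
  hasNE (d (suc i) j) ≡ true → a (suc i) j ≡ a i j →
  a (suc i) (suc j) ≡ a (suc i) j × hasNW (d (suc i) (suc j)) ≡ true
  where open import Relation.Binary.PropositionalEquality using (_≡_)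

CondIII : ℕ → Entries → Decos → Set
CondIII n a d = ∀ i j → 1 ℕ.≤ j → j ℕ.≤ i → i ℕ.< n →
  hasNW (d (suc i) (suc j)) ≡ true → a (suc i) (suc j) ≡ a i j →
  a (suc i) j ≡ a (suc i) (suc j) × hasNE (d (suc i) j) ≡ true
  where open import Relation.Binary.PropositionalEquality using (_≡_)

-- All three conditions and the sign formula are local: they concern one entry x = a i j and its two
-- lower neighbours b = a (i+1) j and c = a (i+1) (j+1). Rows of an AGTP with weakly increasing
-- bottom row are weakly increasing, by downward induction on the row, so b ≤ c at every cell.
-- When b ≤ c the shifted interval ⟨b', c'⟩ differs from [b, c] only in excluding b when b carries ↗
-- and c when c carries ↖, unless both shifts are made and b = c; then ⟨b', c'⟩ = ⟨b+1, b-1⟩ is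
-- negative and equals {b}. This single degenerate case gives exceptions (ii), (iii) and the count N.
module Submission where

open import Defs
open import Data.Nat as ℕ using (ℕ; zero; suc; _∸_; z≤n; s≤s)
import Data.Nat.Properties as ℕ
open import Data.Integer using (ℤ; _≤_; _<_; _+_; _-_; 1ℤ; -1ℤ; _≟_; _<?_)
open import Data.Integer.Properties
  using (≤-refl; ≤-trans; ≤-antisym; <-trans; <⇒≱; ≤∧≢⇒<; i≤i+j; i-j≤i; +-assoc; +-comm;
         +-identityʳ; i<j⇒suc[i]≤j; suc[i]≤j⇒i<j; i<j⇒i≤pred[j]; i≤pred[j]⇒i<j)
open import Data.Bool using (Bool; true; false; if_then_else_; _∧_)
import Data.Bool.Properties as Bool
open import Data.Product using (_×_; _,_; proj₁; proj₂)
open import Data.Sum using (inj₁; inj₂)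
open import Data.Empty using (⊥-elim)
open import Function.Bundles using (_⇔_; mk⇔)
open import Relation.Nullary using (yes; no)
open import Relation.Nullary.Decidable using (⌊_⌋; isYes≗does; dec-true; _×-dec_)
open import Relation.Binary.PropositionalEquality
  using (_≡_; _≢_; refl; sym; trans; cong; cong₂; subst)

i+1-1≡i : ∀ i → i + 1ℤ - 1ℤ ≡ i
i+1-1≡i i = trans (+-assoc i 1ℤ -1ℤ) (+-identityʳ i)

i-1+1≡i : ∀ i → i - 1ℤ + 1ℤ ≡ i
i-1+1≡i i = trans (+-assoc i -1ℤ 1ℤ) (+-identityʳ i)

i<j⇒i+1≤j : ∀ {i j} → i < j → i + 1ℤ ≤ j
i<j⇒i+1≤j {i} rewrite +-comm i 1ℤ = i<j⇒suc[i]≤j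

i+1≤j⇒i<j : ∀ {i j} → i + 1ℤ ≤ j → i < j
i+1≤j⇒i<j {i} rewrite +-comm i 1ℤ = suc[i]≤j⇒i<j

i<j⇒i≤j-1 : ∀ {i j} → i < j → i ≤ j - 1ℤ
i<j⇒i≤j-1 {j = j} rewrite +-comm j -1ℤ = i<j⇒i≤pred[j]

i≤j-1⇒i<j : ∀ {i j} → i ≤ j - 1ℤ → i < j
i≤j-1⇒i<j {j = j} rewrite +-comm j -1ℤ = i≤pred[j]⇒i<j

i<i+1 : ∀ i → i < i + 1ℤ
i<i+1 i = i+1≤j⇒i<j ≤-refl

pred+1<suc : ∀ i → i - 1ℤ + 1ℤ < i + 1ℤ
pred+1<suc i = subst (_< i + 1ℤ) (sym (i-1+1≡i i)) (i<i+1 i)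

i<j+1⇒i≤j : ∀ {i j} → i < j + 1ℤ → i ≤ j
i<j+1⇒i≤j {j = j} i<j+1 = subst (_ ≤_) (i+1-1≡i j) (i<j⇒i≤j-1 i<j+1)

-- left' a d i j and right' a d i j unfold to raiseIf (hasNE _) (a (suc i) j) and
-- lowerIf (hasNW _) (a (suc i) (suc j)), so the lemmas below apply to them directly.
raiseIf : Bool → ℤ → ℤ
raiseIf p b = if p then b + 1ℤ else b

lowerIf : Bool → ℤ → ℤ
lowerIf q c = if q then c - 1ℤ else c

≤-raiseIf : ∀ p b → b ≤ raiseIf p b
≤-raiseIf true  b = i≤i+j b 1ℤ
≤-raiseIf false b = ≤-refl

raiseIf-1≤ : ∀ p b → raiseIf p b - 1ℤ ≤ b
raiseIf-1≤ true  b = subst (_≤ b) (sym (i+1-1≡i b)) ≤-refl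
raiseIf-1≤ false b = i-j≤i b 1ℤ

lowerIf-≤ : ∀ q c → lowerIf q c ≤ c
lowerIf-≤ true  c = i-j≤i c 1ℤ
lowerIf-≤ false c = ≤-refl

≤-lowerIf+1 : ∀ q c → c ≤ lowerIf q c + 1ℤ
≤-lowerIf+1 true  c = subst (c ≤_) (sym (i-1+1≡i c)) ≤-refl
≤-lowerIf+1 false c = i≤i+j c 1ℤ

∈⟨⟩⇒between : ∀ {b c x p q} → b ≤ c → x ∈⟨ raiseIf p b , lowerIf q c ⟩ → b ≤ x × x ≤ c
∈⟨⟩⇒between {b} {c} {p = p} {q} _ (inj₁ (_ , b'≤x , x≤c')) =
  ≤-trans (≤-raiseIf p b) b'≤x , ≤-trans x≤c' (lowerIf-≤ q c)
∈⟨⟩⇒between {b} {c} {p = p} {q} b≤c (inj₂ (_ , c'+1≤x , x≤b'-1)) =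
  ≤-trans b≤c (≤-trans (≤-lowerIf+1 q c) c'+1≤x) , ≤-trans (≤-trans x≤b'-1 (raiseIf-1≤ p b)) b≤c

negative⇒shifted-collapse : ∀ {b c p q} → b ≤ c → lowerIf q c + 1ℤ < raiseIf p b →
  p ≡ true × q ≡ true × b ≡ c
negative⇒shifted-collapse {c = c} {false} {q} b≤c neg =
  ⊥-elim (<⇒≱ neg (≤-trans b≤c (≤-lowerIf+1 q c)))
negative⇒shifted-collapse {p = true} {false} b≤c neg =
  ⊥-elim (<⇒≱ (i+1≤j⇒i<j (i<j+1⇒i≤j neg)) b≤c)
negative⇒shifted-collapse {b} {c} {true} {true} b≤c neg =
  refl , refl , ≤-antisym b≤c (i<j+1⇒i≤j (subst (_< b + 1ℤ) (i-1+1≡i c) neg))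

∈⟨⟩-raised-touch : ∀ {b c x p q} → b ≤ c → x ∈⟨ raiseIf p b , lowerIf q c ⟩ →
  p ≡ true → b ≡ x → c ≡ b × q ≡ true
∈⟨⟩-raised-touch {b} _ (inj₁ (_ , b+1≤b , _)) refl refl = ⊥-elim (<⇒≱ (i<i+1 b) b+1≤b)
∈⟨⟩-raised-touch {q = q} b≤c (inj₂ (neg , _)) refl refl
  with negative⇒shifted-collapse {p = true} {q} b≤c neg
... | _ , q≡true , refl = refl , q≡true

∈⟨⟩-lowered-touch : ∀ {b c x p q} → b ≤ c → x ∈⟨ raiseIf p b , lowerIf q c ⟩ →
  q ≡ true → c ≡ x → b ≡ c × p ≡ true
∈⟨⟩-lowered-touch {c = c} _ (inj₁ (_ , _ , c≤c-1)) refl refl =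
  ⊥-elim (<⇒≱ (i≤j-1⇒i<j ≤-refl) c≤c-1)
∈⟨⟩-lowered-touch {p = p} b≤c (inj₂ (neg , _)) refl refl
  with negative⇒shifted-collapse {p = p} {true} b≤c neg
... | p≡true , _ , refl = refl , p≡true

negativeB-shifted : ∀ {b c x p q} → b ≤ c → x ∈⟨ raiseIf p b , lowerIf q c ⟩ →
  negativeB (raiseIf p b) (lowerIf q c) ≡ (⌊ x ≟ b ⌋ ∧ ⌊ b ≟ c ⌋ ∧ p ∧ q)
negativeB-shifted {b} {c} {x} {p} {q} b≤c x∈ with lowerIf q c + 1ℤ <? raiseIf p b | x∈
... | yes neg | inj₁ (b'≤c' , _) = ⊥-elim (<⇒≱ (<-trans (i<i+1 _) neg) b'≤c')
... | yes neg | inj₂ (_ , c≤x , x≤b) with negative⇒shifted-collapse {p = p} {q} b≤c neg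
...   | refl , refl , refl
  rewrite ≤-antisym (subst (_≤ x) (i-1+1≡i b) c≤x) (subst (x ≤_) (i+1-1≡i b) x≤b)
  = sym (cong₂ _∧_ ⌊x≟x⌋ (cong (_∧ true) ⌊x≟x⌋))
  where
    ⌊x≟x⌋ : ⌊ x ≟ x ⌋ ≡ true
    ⌊x≟x⌋ = trans (isYes≗does (x ≟ x)) (dec-true (x ≟ x) refl)
negativeB-shifted {b} {c} {x} {p} {q} b≤c x∈ | no ¬neg | _ with x ≟ b | b ≟ c | p | q
... | yes _ | yes refl | true  | true  = ⊥-elim (¬neg (pred+1<suc b))
... | yes _ | yes _    | true  | false = refl
... | yes _ | yes _    | false | _     = refl
... | yes _ | no _     | _     | _     = refl
... | no _  | _        | _     | _     = refl

raiseIf-≤ : ∀ p {b x} → b ≤ x → (p ≡ true → b ≢ x) → raiseIf p b ≤ x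
raiseIf-≤ true  b≤x b≢x = i<j⇒i+1≤j (≤∧≢⇒< b≤x (b≢x refl))
raiseIf-≤ false b≤x _   = b≤x

≤-lowerIf : ∀ q {x c} → x ≤ c → (q ≡ true → c ≢ x) → x ≤ lowerIf q c
≤-lowerIf true  x≤c c≢x = i<j⇒i≤j-1 (≤∧≢⇒< x≤c (λ x≡c → c≢x refl (sym x≡c)))
≤-lowerIf false x≤c _   = x≤c

between⇒∈⟨⟩ : ∀ p q {b c x} → b ≤ x → x ≤ c →
  (p ≡ true → b ≡ x → c ≡ b × q ≡ true) →
  (q ≡ true → c ≡ x → b ≡ c × p ≡ true) →
  x ∈⟨ raiseIf p b , lowerIf q c ⟩
between⇒∈⟨⟩ p q {b} {c} {x} b≤x x≤c raised-touch lowered-touch with p Bool.≟ true ×-dec b ≟ x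
... | yes (refl , refl) with raised-touch refl refl
...   | refl , refl =
  inj₂ (pred+1<suc b , subst (_≤ b) (sym (i-1+1≡i b)) ≤-refl , subst (b ≤_) (sym (i+1-1≡i b)) ≤-refl)
between⇒∈⟨⟩ p q {b} {c} {x} b≤x x≤c raised-touch lowered-touch | no ¬touch =
  inj₁ (≤-trans b'≤x x≤c' , b'≤x , x≤c')
  where
    b'≤x : raiseIf p b ≤ x
    b'≤x = raiseIf-≤ p b≤x (λ p≡true b≡x → ¬touch (p≡true , b≡x))
    x≤c' : x ≤ lowerIf q c
    x≤c' = ≤-lowerIf q x≤c λ q≡true c≡x →
      let b≡c , p≡true = lowered-touch q≡true c≡x in ¬touch (p≡true , trans b≡c c≡x)

IncreasingRow : Entries → ℕ → Set
IncreasingRow a r = ∀ j → 1 ℕ.≤ j → j ℕ.< r → a r j ≤ a r (suc j)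

Interlaces : Entries → ℕ → Set
Interlaces a i = ∀ j → 1 ℕ.≤ j → j ℕ.≤ i → a (suc i) j ≤ a i j × a i j ≤ a (suc i) (suc j)

interlaces⇒increasing : ∀ {a i} → Interlaces a i → IncreasingRow a i
interlaces⇒increasing inter j 1≤j j<i =
  ≤-trans (proj₂ (inter j 1≤j (ℕ.<⇒≤ j<i))) (proj₁ (inter (suc j) (s≤s z≤n) j<i))

module _ {n : ℕ} {a : Entries} {d : Decos} (agtp : IsAGTP n a d) where

  interlacesAbove : ∀ {i} → i ℕ.< n → IncreasingRow a (suc i) → Interlaces a i
  interlacesAbove i<n below j 1≤j j≤i =
    ∈⟨⟩⇒between (below j 1≤j (s≤s j≤i)) (agtp _ j 1≤j j≤i i<n)

  increasingAbove : IncreasingRow a n → ∀ m i → m ℕ.+ i ≡ n → IncreasingRow a i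
  increasingAbove bottom zero    i refl = bottom
  increasingAbove bottom (suc m) i m+i≡n =
    interlaces⇒increasing {a} (interlacesAbove i<n (increasingAbove bottom m (suc i) m+1+i≡n))
    where
      m+1+i≡n : m ℕ.+ suc i ≡ n
      m+1+i≡n = trans (ℕ.+-suc m i) m+i≡n
      i<n : i ℕ.< n
      i<n = subst (i ℕ.<_) m+1+i≡n (ℕ.m≤n+m (suc i) m)

  lowerNeighboursOrdered : IncreasingRow a n → ∀ {i j} → i ℕ.< n → j ℕ.≤ i → 1 ℕ.≤ j →
    a (suc i) j ≤ a (suc i) (suc j)
  lowerNeighboursOrdered bottom {i} {j} i<n j≤i 1≤j =
    increasingAbove bottom (n ∸ suc i) (suc i) (ℕ.m∸n+n≡m i<n) j 1≤j (s≤s j≤i)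

countRow-cong : ∀ P Q m → (∀ j → 1 ℕ.≤ j → j ℕ.≤ m → P j ≡ Q j) → countRow P m ≡ countRow Q m
countRow-cong P Q zero    _  = refl
countRow-cong P Q (suc m) eq =
  cong₂ ℕ._+_ (countRow-cong P Q m (λ j 1≤j j≤m → eq j 1≤j (ℕ.m≤n⇒m≤1+n j≤m)))
              (cong (λ t → if t then 1 else 0) (eq (suc m) (s≤s z≤n) ℕ.≤-refl))

countTri'-cong : ∀ P Q m → (∀ i j → 1 ℕ.≤ j → j ℕ.≤ i → i ℕ.≤ m → P i j ≡ Q i j) →
  countTri' P m ≡ countTri' Q m
countTri'-cong P Q zero    _  = refl
countTri'-cong P Q (suc m) eq =
  cong₂ ℕ._+_ (countTri'-cong P Q m (λ i j 1≤j j≤i i≤m → eq i j 1≤j j≤i (ℕ.m≤n⇒m≤1+n i≤m)))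
              (countRow-cong (P (suc m)) (Q (suc m)) (suc m)
                 (λ j 1≤j j≤m → eq (suc m) j 1≤j j≤m ℕ.≤-refl))

≤∸1⇒< : ∀ {i n} → 1 ℕ.≤ n → i ℕ.≤ n ∸ 1 → i ℕ.< n
≤∸1⇒< {n = suc _} _ i≤n-1 = s≤s i≤n-1

proposition3p2 : (n : ℕ) → 1 ℕ.≤ n → (k : ℕ → ℤ) →
    (∀ j → 1 ℕ.≤ j → j ℕ.< n → k j ≤ k (suc j)) →
    (a : Entries) → (d : Decos) →
    (∀ j → 1 ℕ.≤ j → j ℕ.≤ n → a n j ≡ k j) →
    (IsAGTP n a d ⇔ (CondI n a × CondII n a d × CondIII n a d))
    × (IsAGTP n a d → sgn n a d ≡ neg1^ (countTri (specialB a d) n))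
proposition3p2 n 1≤n k k-increasing a d bottom-row = mk⇔ agtp⇒conditions conditions⇒agtp , sign
  where
    bottom : IncreasingRow a n
    bottom j 1≤j j<n rewrite bottom-row j 1≤j (ℕ.<⇒≤ j<n) | bottom-row (suc j) (s≤s z≤n) j<n =
      k-increasing j 1≤j j<n

    ordered : IsAGTP n a d → ∀ {i j} → i ℕ.< n → j ℕ.≤ i → 1 ℕ.≤ j →
      a (suc i) j ≤ a (suc i) (suc j)
    ordered ag = lowerNeighboursOrdered {n} {a} {d} ag bottom

    agtp⇒conditions : IsAGTP n a d → CondI n a × CondII n a d × CondIII n a d
    agtp⇒conditions ag =
      (λ i j 1≤j j≤i i<n → ∈⟨⟩⇒between (ordered ag i<n j≤i 1≤j) (ag i j 1≤j j≤i i<n)) ,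
      (λ i j 1≤j j≤i i<n → ∈⟨⟩-raised-touch (ordered ag i<n j≤i 1≤j) (ag i j 1≤j j≤i i<n)) ,
      (λ i j 1≤j j≤i i<n → ∈⟨⟩-lowered-touch (ordered ag i<n j≤i 1≤j) (ag i j 1≤j j≤i i<n))

    conditions⇒agtp : CondI n a × CondII n a d × CondIII n a d → IsAGTP n a d
    conditions⇒agtp (interlacing , raised , lowered) i j 1≤j j≤i i<n =
      let b≤x , x≤c = interlacing i j 1≤j j≤i i<n in
      between⇒∈⟨⟩ _ _ b≤x x≤c (raised i j 1≤j j≤i i<n) (lowered i j 1≤j j≤i i<n)

    sign : IsAGTP n a d → sgn n a d ≡ neg1^ (countTri (specialB a d) n)
    sign ag = cong neg1^ (countTri'-cong _ _ (n ∸ 1) λ i j 1≤j j≤i i≤n-1 →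
      let i<n = ≤∸1⇒< 1≤n i≤n-1 in
      negativeB-shifted (ordered ag i<n j≤i 1≤j) (ag i j 1≤j j≤i i<n))
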